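{- Let $x$ and $y$ be positive integers with $\gcd(x,y) = 1$. Then $D(xy) \leq D(x)D(y)$.
   Context: For a positive integer $n$, $\sigma(n)$ denotes the sum of the positive divisors of $n$, and $D(n) = 2n - \sigma(n)$ is the deficiency of $n$ (an integer that may be positive, zero, or negative). -}

module Defs where

open import Data.Nat using (ℕ; zero; suc; _+_; _*_)
open import Data.Nat.Divisibility using (_∣_; _∣?_)
open import Data.List using (List; map; filter; upTo)
open import Data.Nat.ListAction using (sum)
open import Data.Integer using (ℤ; +_; _-_)
import Data.Integer as ℤ
open import Relation.Nullary.Decidable using (does)

divisors : ℕ → List ℕ
divisors n = filter (λ d → d ∣? n) (map suc (upTo n))

σ : ℕ → ℕ
σ n = sum (divisors n)

D : ℕ → ℤ
D n = + (2 * n) - + σ n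

{-# OPTIONS --safe #-}
-- For a divisor d of n = xy with gcd x y ≡ 1, x ∣ d and y ∣ d force n ∣ d, so
-- [x ∣ d] + [y ∣ d] ≤ 1 + [n ∣ d]. Weighting by d and summing over d ∣ n, the divisors of n
-- that are multiples of x are exactly x e with e ∣ y, whence x σ(y) + y σ(x) ≤ σ(n) + n.
-- Then D(x) D(y) − D(xy) = (σ(x) − x)(σ(y) − y) + (σ(xy) + xy − x σ(y) − y σ(x)) ≥ 0,
-- both summands being nonnegative because n ≤ σ(n).
module Submission where

open import Defs
open import Data.Nat using (ℕ; _*_; NonZero)
open import Data.Nat.GCD using (gcd)
open import Data.Integer using (_≤_)
import Data.Integer as ℤ
open import Relation.Binary.PropositionalEquality using (_≡_)

open import Data.Nat using (zero; suc; _+_; _<_; z≤n; s≤s)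
import Data.Nat as ℕ
open import Data.Nat.Properties
open import Data.Nat.Divisibility
open import Data.Nat.LCM using (lcm; lcm-least; gcd*lcm)
open import Data.Nat.ListAction using (sum)
open import Data.Nat.Tactic.RingSolver using (solve-∀)
import Data.Integer.Properties as ℤₚ
import Data.Integer.Tactic.RingSolver as ℤ-Solver
open import Data.List using (filter; applyUpTo)
open import Data.List.Properties using (map-upTo)
open import Data.Bool using (if_then_else_)
open import Data.Product using (_,_)
open import Relation.Nullary using (Dec; yes; no; does; contradiction; ¬_)
open import Relation.Unary using (Pred; Decidable)
open import Relation.Binary.PropositionalEquality
  using (refl; sym; trans; cong; cong₂; subst; subst₂; module ≡-Reasoning)

[_]·_ : {P : Set} → Dec P → ℕ → ℕ
[ p? ]· v = if does p? then v else 0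

infixr 9 [_]·_

[]·-yes : {P : Set} (p? : Dec P) → P → ∀ v → [ p? ]· v ≡ v
[]·-yes (yes _) _ v = refl
[]·-yes (no ¬p) p v = contradiction p ¬p

[]·-no : {P : Set} (p? : Dec P) → ¬ P → ∀ v → [ p? ]· v ≡ 0
[]·-no (yes p) ¬p v = contradiction p ¬p
[]·-no (no _) _ v = refl

[]·-≤ : {P : Set} (p? : Dec P) → ∀ v → [ p? ]· v ℕ.≤ v
[]·-≤ (yes _) v = ≤-refl
[]·-≤ (no _) v = z≤n

[]·-cong : {P Q : Set} (p? : Dec P) (q? : Dec Q) → (P → Q) → (Q → P) → ∀ v → [ p? ]· v ≡ [ q? ]· v
[]·-cong (yes _) (yes _) _ _ v = refl
[]·-cong (no _) (no _) _ _ v = refl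
[]·-cong (yes p) (no ¬q) p⇒q _ v = contradiction (p⇒q p) ¬q
[]·-cong (no ¬p) (yes q) _ q⇒p v = contradiction (q⇒p q) ¬p

[]·-*-comm : {P : Set} (p? : Dec P) → ∀ c v → [ p? ]· (c * v) ≡ c * [ p? ]· v
[]·-*-comm (yes _) c v = refl
[]·-*-comm (no _) c v = sym (*-zeroʳ c)

[]·-+-≤ : {P Q R : Set} (p? : Dec P) (q? : Dec Q) (r? : Dec R) → (P → Q → R) →
  ∀ v → [ p? ]· v + [ q? ]· v ℕ.≤ v + [ r? ]· v
[]·-+-≤ (yes _) (yes _) (yes _) _ v = ≤-refl
[]·-+-≤ (yes p) (yes q) (no ¬r) p⇒q⇒r v = contradiction (p⇒q⇒r p q) ¬r
[]·-+-≤ (yes _) (no _) r? _ v = ≤-trans (≤-reflexive (+-identityʳ v)) (m≤m+n v _)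
[]·-+-≤ (no _) q? r? _ v = ≤-trans ([]·-≤ q? v) (m≤m+n v _)

∑ : ℕ → (ℕ → ℕ) → ℕ
∑ zero f = 0
∑ (suc n) f = f 0 + ∑ n (λ i → f (suc i))

infix 8 ∑
syntax ∑ n (λ i → f) = ∑[ i < n ] f

∑-cong : ∀ n {f g : ℕ → ℕ} → (∀ i → f i ≡ g i) → ∑ n f ≡ ∑ n g
∑-cong zero f≡g = refl
∑-cong (suc n) f≡g = cong₂ _+_ (f≡g 0) (∑-cong n (λ i → f≡g (suc i)))

∑-vanishing : ∀ n {f : ℕ → ℕ} → (∀ i → i < n → f i ≡ 0) → ∑ n f ≡ 0
∑-vanishing zero f≡0 = refl
∑-vanishing (suc n) f≡0 =
  cong₂ _+_ (f≡0 0 (s≤s z≤n)) (∑-vanishing n (λ i i<n → f≡0 (suc i) (s≤s i<n)))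

∑-mono-≤ : ∀ n {f g : ℕ → ℕ} → (∀ i → f i ℕ.≤ g i) → ∑ n f ℕ.≤ ∑ n g
∑-mono-≤ zero f≤g = z≤n
∑-mono-≤ (suc n) f≤g = +-mono-≤ (f≤g 0) (∑-mono-≤ n (λ i → f≤g (suc i)))

∑-distrib-+ : ∀ n (f g : ℕ → ℕ) → ∑[ i < n ] (f i + g i) ≡ ∑ n f + ∑ n g
∑-distrib-+ zero f g = refl
∑-distrib-+ (suc n) f g = begin
  (f 0 + g 0) + ∑[ i < n ] (f (suc i) + g (suc i))
    ≡⟨ cong (f 0 + g 0 +_) (∑-distrib-+ n (λ i → f (suc i)) (λ i → g (suc i))) ⟩
  (f 0 + g 0) + (∑[ i < n ] f (suc i) + ∑[ i < n ] g (suc i))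
    ≡⟨ +-assoc-swap (f 0) (g 0) _ _ ⟩
  (f 0 + ∑[ i < n ] f (suc i)) + (g 0 + ∑[ i < n ] g (suc i)) ∎
  where
  open ≡-Reasoning
  +-assoc-swap : ∀ a b c d → (a + b) + (c + d) ≡ (a + c) + (b + d)
  +-assoc-swap = solve-∀

∑-distribˡ-* : ∀ n c (f : ℕ → ℕ) → c * ∑ n f ≡ ∑[ i < n ] (c * f i)
∑-distribˡ-* zero c f = *-zeroʳ c
∑-distribˡ-* (suc n) c f =
  trans (*-distribˡ-+ c (f 0) _) (cong (c * f 0 +_) (∑-distribˡ-* n c (λ i → f (suc i))))

∑-+ : ∀ m n (f : ℕ → ℕ) → ∑ (m + n) f ≡ ∑ m f + ∑[ j < n ] f (m + j)
∑-+ zero n f = refl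
∑-+ (suc m) n f = trans (cong (f 0 +_) (∑-+ m n (λ i → f (suc i)))) (sym (+-assoc (f 0) _ _))

∑-suc : ∀ n (f : ℕ → ℕ) → ∑ (suc n) f ≡ ∑ n f + f n
∑-suc n f = begin
  ∑ (suc n) f                ≡⟨ cong (λ k → ∑ k f) (+-comm 1 n) ⟩
  ∑ (n + 1) f                ≡⟨ ∑-+ n 1 f ⟩
  ∑ n f + (f (n + 0) + 0)    ≡⟨ cong (λ k → ∑ n f + k) (trans (+-identityʳ _) (cong f (+-identityʳ n))) ⟩
  ∑ n f + f n                ∎
  where open ≡-Reasoning

sum-filter-applyUpTo : ∀ {P : Pred ℕ _} (P? : Decidable P) g n →
  sum (filter P? (applyUpTo g n)) ≡ ∑[ i < n ] [ P? (g i) ]· g i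
sum-filter-applyUpTo P? g zero = refl
sum-filter-applyUpTo P? g (suc n) with P? (g 0)
... | yes _ = cong (g 0 +_) (sum-filter-applyUpTo P? (λ i → g (suc i)) n)
... | no _ = sum-filter-applyUpTo P? (λ i → g (suc i)) n

σ-as-∑ : ∀ n → σ n ≡ ∑[ i < n ] [ suc i ∣? n ]· suc i
σ-as-∑ n = trans (cong (λ ds → sum (filter (_∣? n) ds)) (map-upTo suc n))
                 (sum-filter-applyUpTo (_∣? n) suc n)

∑-first-multiple : ∀ m .{{_ : NonZero m}} (h : ℕ → ℕ) → ∑[ i < m ] [ m ∣? suc i ]· h (suc i) ≡ h m
∑-first-multiple (suc k) h = begin
  ∑[ i < suc k ] [ suc k ∣? suc i ]· h (suc i)   ≡⟨ ∑-suc k _ ⟩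
  ∑[ i < k ] [ suc k ∣? suc i ]· h (suc i) + [ suc k ∣? suc k ]· h (suc k)
    ≡⟨ cong₂ _+_ (∑-vanishing k (λ i i<k → []·-no (suc k ∣? suc i) (>⇒∤ (s≤s i<k)) _))
                 ([]·-yes (suc k ∣? suc k) ∣-refl _) ⟩
  h (suc k)                                       ∎
  where open ≡-Reasoning

∑-multiples : ∀ m .{{_ : NonZero m}} N (h : ℕ → ℕ) →
  ∑[ i < m * N ] [ m ∣? suc i ]· h (suc i) ≡ ∑[ k < N ] h (m * suc k)
∑-multiples m zero h rewrite *-zeroʳ m = refl
∑-multiples m (suc N) h = begin
  ∑[ i < m * suc N ] [ m ∣? suc i ]· h (suc i)
    ≡⟨ cong (λ n → ∑ n f) (*-suc m N) ⟩
  ∑[ i < m + m * N ] [ m ∣? suc i ]· h (suc i)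
    ≡⟨ ∑-+ m (m * N) _ ⟩
  ∑[ i < m ] [ m ∣? suc i ]· h (suc i) + ∑[ j < m * N ] [ m ∣? suc (m + j) ]· h (suc (m + j))
    ≡⟨ cong₂ _+_ (∑-first-multiple m h) (∑-cong (m * N) shift) ⟩
  h m + ∑[ j < m * N ] [ m ∣? suc j ]· h (m + suc j)
    ≡⟨ cong₂ _+_ (cong h (sym (*-identityʳ m))) (∑-multiples m N (λ d → h (m + d))) ⟩
  h (m * 1) + ∑[ k < N ] h (m + m * suc k)
    ≡⟨ cong (h (m * 1) +_) (∑-cong N (λ k → cong h (sym (*-suc m (suc k))))) ⟩
  ∑[ k < suc N ] h (m * suc k) ∎
  where
  open ≡-Reasoning
  f : ℕ → ℕ
  f i = [ m ∣? suc i ]· h (suc i)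
  shift : ∀ j → [ m ∣? suc (m + j) ]· h (suc (m + j)) ≡ [ m ∣? suc j ]· h (m + suc j)
  shift j rewrite sym (+-suc m j) =
    []·-cong (m ∣? m + suc j) (m ∣? suc j) (λ m∣m+n → ∣m+n∣m⇒∣n m∣m+n ∣-refl) (∣m∣n⇒∣m+n ∣-refl) _

σ-multiplesOf : ℕ → ℕ → ℕ
σ-multiplesOf m n = ∑[ i < n ] [ m ∣? suc i ]· [ suc i ∣? n ]· suc i

σ-multiplesOf-* : ∀ m .{{_ : NonZero m}} n → σ-multiplesOf m (m * n) ≡ m * σ n
σ-multiplesOf-* m n = begin
  σ-multiplesOf m (m * n)                          ≡⟨ ∑-multiples m n (λ d → [ d ∣? m * n ]· d) ⟩
  ∑[ k < n ] [ m * suc k ∣? m * n ]· (m * suc k)   ≡⟨ ∑-cong n cancel-m ⟩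
  ∑[ k < n ] (m * [ suc k ∣? n ]· suc k)           ≡⟨ sym (∑-distribˡ-* n m _) ⟩
  m * ∑[ k < n ] [ suc k ∣? n ]· suc k             ≡⟨ cong (m *_) (sym (σ-as-∑ n)) ⟩
  m * σ n                                          ∎
  where
  open ≡-Reasoning
  cancel-m : ∀ k → [ m * suc k ∣? m * n ]· (m * suc k) ≡ m * [ suc k ∣? n ]· suc k
  cancel-m k = trans ([]·-cong (m * suc k ∣? m * n) (suc k ∣? n) (*-cancelˡ-∣ m) (*-monoʳ-∣ m) _)
                     ([]·-*-comm (suc k ∣? n) m (suc k))

σ-multiplesOf-self : ∀ n .{{_ : NonZero n}} → σ-multiplesOf n n ≡ n
σ-multiplesOf-self n =
  subst (λ k → σ-multiplesOf n k ≡ k) (*-identityʳ n) (σ-multiplesOf-* n 1)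

σ-multiplesOf≤σ : ∀ m n → σ-multiplesOf m n ℕ.≤ σ n
σ-multiplesOf≤σ m n =
  subst (σ-multiplesOf m n ℕ.≤_) (sym (σ-as-∑ n)) (∑-mono-≤ n (λ i → []·-≤ (m ∣? suc i) _))

n≤σ[n] : ∀ n .{{_ : NonZero n}} → n ℕ.≤ σ n
n≤σ[n] n = subst (ℕ._≤ σ n) (σ-multiplesOf-self n) (σ-multiplesOf≤σ n n)

gcd≡1⇒lcm≡* : ∀ m n → gcd m n ≡ 1 → lcm m n ≡ m * n
gcd≡1⇒lcm≡* m n gcd≡1 = begin
  lcm m n            ≡⟨ sym (*-identityˡ _) ⟩
  1 * lcm m n        ≡⟨ cong (_* lcm m n) (sym gcd≡1) ⟩
  gcd m n * lcm m n  ≡⟨ gcd*lcm m n ⟩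
  m * n              ∎
  where open ≡-Reasoning

coprime-∣⇒*∣ : ∀ {m n d} → gcd m n ≡ 1 → m ∣ d → n ∣ d → m * n ∣ d
coprime-∣⇒*∣ {m} {n} gcd≡1 m∣d n∣d = subst (_∣ _) (gcd≡1⇒lcm≡* m n gcd≡1) (lcm-least m∣d n∣d)

σ-coprime-≤ : ∀ x y .{{_ : NonZero x}} .{{_ : NonZero y}} → gcd x y ≡ 1 →
  x * σ y + y * σ x ℕ.≤ σ (x * y) + x * y
σ-coprime-≤ x y gcd≡1 = begin
  x * σ y + y * σ x
    ≡⟨ sym (cong₂ _+_ (σ-multiplesOf-* x y) σ-multiplesOf-y) ⟩
  σ-multiplesOf x n + σ-multiplesOf y n
    ≡⟨ sym (∑-distrib-+ n _ _) ⟩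
  ∑[ i < n ] ([ x ∣? suc i ]· v i + [ y ∣? suc i ]· v i)
    ≤⟨ ∑-mono-≤ n (λ i → []·-+-≤ (x ∣? suc i) (y ∣? suc i) (n ∣? suc i) (coprime-∣⇒*∣ gcd≡1) (v i)) ⟩
  ∑[ i < n ] (v i + [ n ∣? suc i ]· v i)
    ≡⟨ ∑-distrib-+ n _ _ ⟩
  ∑ n v + σ-multiplesOf n n
    ≡⟨ cong₂ _+_ (sym (σ-as-∑ n)) (σ-multiplesOf-self n) ⟩
  σ n + n ∎
  where
  open ≤-Reasoning
  n = x * y
  instance
    n≢0 : NonZero n
    n≢0 = m*n≢0 x y
  v : ℕ → ℕ
  v i = [ suc i ∣? n ]· suc i
  σ-multiplesOf-y : σ-multiplesOf y n ≡ y * σ x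
  σ-multiplesOf-y = subst (λ k → σ-multiplesOf y k ≡ y * σ x) (*-comm y x) (σ-multiplesOf-* y x)

m≤n⇒o≤p⇒m*p+o*n≤n*p+m*o : ∀ {m n o p} → m ℕ.≤ n → o ℕ.≤ p → m * p + o * n ℕ.≤ n * p + m * o
m≤n⇒o≤p⇒m*p+o*n≤n*p+m*o {m} {o = o} m≤n o≤p
  with m≤n⇒∃[o]m+o≡n m≤n | m≤n⇒∃[o]m+o≡n o≤p
... | a , refl | b , refl = begin
  m * (o + b) + o * (m + a)            ≤⟨ m≤m+n _ (a * b) ⟩
  m * (o + b) + o * (m + a) + a * b    ≡⟨ expand m o a b ⟩
  (m + a) * (o + b) + m * o            ∎
  where
  open ≤-Reasoning
  expand : ∀ m o a b → m * (o + b) + o * (m + a) + a * b ≡ (m + a) * (o + b) + m * o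
  expand = solve-∀

pos-difference-* : ∀ m n o p →
  (ℤ.+ m ℤ.- ℤ.+ n) ℤ.* (ℤ.+ o ℤ.- ℤ.+ p) ≡ ℤ.+ (m * o + n * p) ℤ.- ℤ.+ (m * p + n * o)
pos-difference-* m n o p = begin
  (ℤ.+ m ℤ.- ℤ.+ n) ℤ.* (ℤ.+ o ℤ.- ℤ.+ p)
    ≡⟨ expand (ℤ.+ m) (ℤ.+ n) (ℤ.+ o) (ℤ.+ p) ⟩
  (ℤ.+ m ℤ.* ℤ.+ o ℤ.+ ℤ.+ n ℤ.* ℤ.+ p) ℤ.- (ℤ.+ m ℤ.* ℤ.+ p ℤ.+ ℤ.+ n ℤ.* ℤ.+ o)
    ≡⟨ sym (cong₂ ℤ._-_ (pos-*+* m o n p) (pos-*+* m p n o)) ⟩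
  ℤ.+ (m * o + n * p) ℤ.- ℤ.+ (m * p + n * o) ∎
  where
  open ≡-Reasoning
  expand : ∀ (M N O P : ℤ.ℤ) → (M ℤ.- N) ℤ.* (O ℤ.- P) ≡ (M ℤ.* O ℤ.+ N ℤ.* P) ℤ.- (M ℤ.* P ℤ.+ N ℤ.* O)
  expand = ℤ-Solver.solve-∀
  pos-*+* : ∀ a b c d → ℤ.+ (a * b + c * d) ≡ ℤ.+ a ℤ.* ℤ.+ b ℤ.+ ℤ.+ c ℤ.* ℤ.+ d
  pos-*+* a b c d = trans (ℤₚ.pos-+ (a * b) (c * d)) (cong₂ ℤ._+_ (ℤₚ.pos-* a b) (ℤₚ.pos-* c d))

pos-difference-≤ : ∀ {m n o p} → m + p ℕ.≤ o + n → ℤ.+ m ℤ.- ℤ.+ n ≤ ℤ.+ o ℤ.- ℤ.+ p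
pos-difference-≤ {m} {n} {o} {p} m+p≤o+n = begin
  ℤ.+ m ℤ.- ℤ.+ n        ≡⟨ ℤₚ.[+m]-[+n]≡m⊖n m n ⟩
  m ℤ.⊖ n                ≡⟨ sym (ℤₚ.+-cancelˡ-⊖ p m n) ⟩
  (p + m) ℤ.⊖ (p + n)    ≤⟨ ℤₚ.⊖-monoˡ-≤ (p + n) (subst₂ ℕ._≤_ (+-comm m p) (+-comm o n) m+p≤o+n) ⟩
  (n + o) ℤ.⊖ (p + n)    ≡⟨ cong (n + o ℤ.⊖_) (+-comm p n) ⟩
  (n + o) ℤ.⊖ (n + p)    ≡⟨ ℤₚ.+-cancelˡ-⊖ n o p ⟩
  o ℤ.⊖ p                ≡⟨ sym (ℤₚ.[+m]-[+n]≡m⊖n o p) ⟩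
  ℤ.+ o ℤ.- ℤ.+ p        ∎
  where open ℤₚ.≤-Reasoning

deficiency-bound : ∀ {x y a b s} → x ℕ.≤ a → y ℕ.≤ b → x * b + y * a ℕ.≤ s + x * y →
  ℤ.+ (2 * (x * y)) ℤ.- ℤ.+ s ≤ (ℤ.+ (2 * x) ℤ.- ℤ.+ a) ℤ.* (ℤ.+ (2 * y) ℤ.- ℤ.+ b)
deficiency-bound {x} {y} {a} {b} {s} x≤a y≤b xb+ya≤s+xy =
  ℤₚ.≤-trans (pos-difference-≤ {2 * (x * y)} {s} {2 * x * (2 * y) + a * b} cross-≤)
             (ℤₚ.≤-reflexive (sym (pos-difference-* (2 * x) a (2 * y) b)))
  where
  cross-≤ : 2 * (x * y) + (2 * x * b + a * (2 * y)) ℕ.≤ (2 * x * (2 * y) + a * b) + s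
  cross-≤ = begin
    2 * (x * y) + (2 * x * b + a * (2 * y))
      ≡⟨ regroupˡ x y a b ⟩
    2 * (x * y) + ((x * b + y * a) + (x * b + y * a))
      ≤⟨ +-monoʳ-≤ (2 * (x * y)) (+-mono-≤ xb+ya≤s+xy (m≤n⇒o≤p⇒m*p+o*n≤n*p+m*o x≤a y≤b)) ⟩
    2 * (x * y) + ((s + x * y) + (a * b + x * y))
      ≡⟨ regroupʳ x y a b s ⟩
    (2 * x * (2 * y) + a * b) + s ∎
    where
    open ≤-Reasoning
    regroupˡ : ∀ x y a b →
      2 * (x * y) + (2 * x * b + a * (2 * y)) ≡ 2 * (x * y) + ((x * b + y * a) + (x * b + y * a))
    regroupˡ = solve-∀
    regroupʳ : ∀ x y a b s →
      2 * (x * y) + ((s + x * y) + (a * b + x * y)) ≡ (2 * x * (2 * y) + a * b) + s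
    regroupʳ = solve-∀

lemma2 : (x y : ℕ) → NonZero x → NonZero y → gcd x y ≡ 1 →
    D (x * y) ≤ D x ℤ.* D y
lemma2 x y x≢0 y≢0 gcd≡1 =
  deficiency-bound (n≤σ[n] x {{x≢0}}) (n≤σ[n] y {{y≢0}}) (σ-coprime-≤ x y {{x≢0}} {{y≢0}} gcd≡1)
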